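{- Let $G=(V^+,V^-;E)$ be a balanced bipartite graph and let $T\subseteq E$ be (the edge set of) a spanning tree of $G$. The following are equivalent: (1) $T$ contains a perfect matching $M$ of $G$ such that $\overrightarrow{T\setminus M}\cup\overleftarrow{M}$ is a spanning in-arborescence of $G_M$ (rooted at some vertex of $V^+$); (2) there exists a vertex $r\in V^+$ such that $\deg_T(r)=1$ and $\deg_T(v)=2$ for every $v\in V^+\setminus\{r\}$.
   Context: A bipartite graph $G=(V^+,V^-;E)$ is balanced if $|V^+|=|V^-|$. For each edge $e=\{u,v\}$ with $u\in V^+$, $v\in V^-$ write $\overrightarrow{e}=(u,v)$ and $\overleftarrow{e}=(v,u)$, and for $F\subseteq E$ let $\overrightarrow{F}=\{\overrightarrow{e}:e\in F\}$, $\overleftarrow{F}=\{\overleftarrow{e}:e\in F\}$. For a perfect matching $M$ of $G$, the auxiliary digraph is $G_M=(V^+\cup V^-,\ \overrightarrow{E}\cup\overleftarrow{M})$. An in-arborescence rooted at $r$ is a connected digraph in which $r$ has out-degree $0$ and every other vertex has out-degree $1$; spanning means it contains all vertices. $\deg_T(v)$ is the number of edges of $T$ incident to $v$. -}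

module Defs where

open import Data.Nat using (ℕ; zero; suc; _+_; _≤_)
open import Data.Fin using (Fin)
open import Data.Bool using (Bool; true; false; _∧_; not; if_then_else_)
open import Data.Sum using (_⊎_; inj₁; inj₂)
open import Data.Product using (Σ; _×_; _,_)
open import Data.List using (List; []; _∷_; _++_; length; allFin; map)
open import Data.Nat.ListAction using (sum)
open import Data.List.Relation.Unary.Unique.Propositional using (Unique)
open import Data.Empty using (⊥)
open import Relation.Binary.PropositionalEquality using (_≡_; _≢_)
open import Relation.Nullary using (¬_)

-- Balanced bipartite graph G = (V⁺, V⁻; E) with V⁺ = V⁻-sized = Fin n.
-- Vertices: inj₁ u is u ∈ V⁺, inj₂ v is v ∈ V⁻.
Vtx : ℕ → Set
Vtx n = Fin n ⊎ Fin n

-- An edge set F ⊆ V⁺ × V⁻, as a decidable relation: F u v ≡ true iff {u,v} ∈ F.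
EdgeSet : ℕ → Set
EdgeSet n = Fin n → Fin n → Bool

Digraph : ℕ → Set
Digraph n = Vtx n → Vtx n → Bool

_⊆ₑ_ : ∀ {n} → EdgeSet n → EdgeSet n → Set
F ⊆ₑ H = ∀ u v → F u v ≡ true → H u v ≡ true

count : ∀ {n} → (Fin n → Bool) → ℕ
count {n} p = sum (map (λ i → if p i then 1 else 0) (allFin n))

countV : ∀ {n} → (Vtx n → Bool) → ℕ
countV p = count (λ u → p (inj₁ u)) + count (λ v → p (inj₂ v))

deg : ∀ {n} → EdgeSet n → Vtx n → ℕ
deg F (inj₁ u) = count (λ v → F u v)
deg F (inj₂ v) = count (λ u → F u v)

UAdj : ∀ {n} → EdgeSet n → Vtx n → Vtx n → Set
UAdj F (inj₁ u) (inj₂ v) = F u v ≡ true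
UAdj F (inj₂ v) (inj₁ u) = F u v ≡ true
UAdj F (inj₁ _) (inj₁ _) = ⊥
UAdj F (inj₂ _) (inj₂ _) = ⊥

data Reach {A : Set} (R : A → A → Set) : A → A → Set where
  here  : ∀ {x} → Reach R x x
  there : ∀ {x y z} → R x y → Reach R y z → Reach R x z

Connected : {A : Set} → (A → A → Set) → Set
Connected R = ∀ x y → Reach R x y

data Chain {A : Set} (R : A → A → Set) : List A → Set where
  nil  : Chain R []
  one  : ∀ {x} → Chain R (x ∷ [])
  cons : ∀ {x y zs} → R x y → Chain R (y ∷ zs) → Chain R (x ∷ y ∷ zs)

HasCycle : {A : Set} → (A → A → Set) → Set
HasCycle {A} R = Σ A λ x → Σ (List A) λ ys →
  (2 ≤ length ys) × Unique (x ∷ ys) × Chain R (x ∷ ys ++ x ∷ [])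

IsSpanningTree : ∀ {n} → EdgeSet n → EdgeSet n → Set
IsSpanningTree E T = (T ⊆ₑ E) × Connected (UAdj T) × ¬ HasCycle (UAdj T)

IsPerfectMatching : ∀ {n} → EdgeSet n → EdgeSet n → Set
IsPerfectMatching E M = (M ⊆ₑ E) × (∀ x → deg M x ≡ 1)

-- the arc set  →E ∪ ←F'  for edge sets F (oriented V⁺→V⁻) and F' (oriented V⁻→V⁺)
orient : ∀ {n} → EdgeSet n → EdgeSet n → Digraph n
orient F F' (inj₁ u) (inj₂ v) = F u v
orient F F' (inj₂ v) (inj₁ u) = F' u v
orient F F' (inj₁ _) (inj₁ _) = false
orient F F' (inj₂ _) (inj₂ _) = false

auxDigraph : ∀ {n} → EdgeSet n → EdgeSet n → Digraph n
auxDigraph E M = orient E M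

_∖ₑ_ : ∀ {n} → EdgeSet n → EdgeSet n → EdgeSet n
(F ∖ₑ M) u v = F u v ∧ not (M u v)

outdeg : ∀ {n} → Digraph n → Vtx n → ℕ
outdeg D x = countV (D x)

Underlying : ∀ {n} → Digraph n → Vtx n → Vtx n → Set
Underlying D x y = (D x y ≡ true) ⊎ (D y x ≡ true)

IsSpanningInArborescence : ∀ {n} → Digraph n → Digraph n → Vtx n → Set
IsSpanningInArborescence H D r =
  (∀ x y → D x y ≡ true → H x y ≡ true) ×
  Connected (Underlying D) ×
  (outdeg D r ≡ 0) ×
  (∀ x → x ≢ r → outdeg D x ≡ 1)

{-# OPTIONS --safe #-}
-- Let dist be the distance from r in T, and M the tree edges uv (u ∈ V⁺) with dist u < dist v.
-- Every v ∈ V⁻ meets M (in the first edge of a shortest path to r) and every u ∈ V⁺ ∖ {r} meets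
-- T ∖ M, so deg_T(u) = 1 + [u ≠ r] forces deg_M(u) ≤ 1 while deg_M(v) ≥ 1; counting the edges of M
-- from both sides makes M perfect.  In →(T∖M) ∪ ←M a vertex v ∈ V⁻ then has out-degree deg_M(v) = 1
-- and u ∈ V⁺ has out-degree deg_T(u) − 1; this identity also gives (1) ⇒ (2).
module Submission where

open import Defs
open import Data.Nat using (ℕ; zero; suc; _+_; _≤_; _<_; _<?_; z≤n; s≤s)
open import Data.Nat.Properties
  using (≤-refl; ≤-trans; ≤-reflexive; ≤-antisym; ≮⇒≥; m<1+n⇒m<n∨m≡n; m≤m+n; +-mono-≤; +-monoʳ-≤;
         +-monoˡ-≤; +-cancelˡ-≤; +-cancelʳ-≤; m≤n+m; <-asym; suc-injective; +-comm; +-identityʳ;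
         +-0-commutativeMonoid; module ≤-Reasoning)
open import Data.Fin using (Fin; zero; suc; _≟_)
open import Data.Fin.Properties using (any?)
open import Data.Sum using (_⊎_; inj₁; inj₂; [_,_]′)
open import Data.Sum.Properties using (inj₁-injective; ≡-dec)
open import Data.Product using (Σ; ∃; _×_; _,_; proj₁; proj₂)
open import Data.Bool using (Bool; true; false; _∧_; not; if_then_else_)
import Data.Bool.Properties as Bool
open import Data.List using (tabulate)
open import Data.List.Properties using (map-tabulate)
import Data.Nat.ListAction as List
open import Data.Empty using (⊥-elim)
open import Relation.Nullary using (¬_; Dec; yes; no; does)
open import Relation.Nullary.Decidable using (_⊎-dec_; _×-dec_; map′; dec-true; dec-false)
open import Relation.Unary using (Decidable)
open import Relation.Binary.PropositionalEquality using (_≡_; _≢_; refl; sym; trans; cong; cong₂; module ≡-Reasoning)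
open import Function using (_∘_)
open import Function.Bundles using (_⇔_; mk⇔)
open import Algebra.Properties.CommutativeMonoid.Sum +-0-commutativeMonoid
  using (sum-syntax; sum-cong-≗; sum-remove; sum-replicate-zero; ∑-distrib-+; ∑-comm)

private
  variable
    n : ℕ

∑-mono-≤ : {f g : Fin n → ℕ} → (∀ i → f i ≤ g i) → ∑[ i < n ] f i ≤ ∑[ i < n ] g i
∑-mono-≤ {zero}  f≤g = z≤n
∑-mono-≤ {suc n} f≤g = +-mono-≤ (f≤g zero) (∑-mono-≤ (f≤g ∘ suc))

+-mono-≤-rigid : ∀ {a b c d} → a ≤ c → b ≤ d → c + d ≤ a + b → a ≡ c × b ≡ d
+-mono-≤-rigid {a} {b} {c} {d} a≤c b≤d c+d≤a+b = ≤-antisym a≤c c≤a , ≤-antisym b≤d d≤b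
  where
  c≤a : c ≤ a
  c≤a = +-cancelʳ-≤ d c a (≤-trans c+d≤a+b (+-monoʳ-≤ a b≤d))
  d≤b : d ≤ b
  d≤b = +-cancelˡ-≤ c d b (≤-trans c+d≤a+b (+-mono-≤ a≤c ≤-refl))

∑-mono-≤-rigid : {f g : Fin n → ℕ} → (∀ i → f i ≤ g i) → ∑[ i < n ] g i ≤ ∑[ i < n ] f i →
                 ∀ i → f i ≡ g i
∑-mono-≤-rigid {suc n} f≤g ∑g≤∑f i with +-mono-≤-rigid (f≤g zero) (∑-mono-≤ (f≤g ∘ suc)) ∑g≤∑f
∑-mono-≤-rigid {suc n} f≤g ∑g≤∑f zero    | f₀≡g₀ , _     = f₀≡g₀
∑-mono-≤-rigid {suc n} f≤g ∑g≤∑f (suc i) | _     , ∑f≡∑g =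
  ∑-mono-≤-rigid (f≤g ∘ suc) (≤-reflexive (sym ∑f≡∑g)) i

term≤∑ : (f : Fin n → ℕ) (i : Fin n) → f i ≤ ∑[ j < n ] f j
term≤∑ {suc n} f i = ≤-trans (m≤m+n _ _) (≤-reflexive (sym (sum-remove {i = i} f)))

indicator : Bool → ℕ
indicator b = if b then 1 else 0

count≡∑ : (p : Fin n → Bool) → count p ≡ ∑[ i < n ] indicator (p i)
count≡∑ {n} p =
  trans (cong List.sum (map-tabulate (λ i → i) (indicator ∘ p))) (sum-tabulate (indicator ∘ p))
  where
  sum-tabulate : ∀ {m} (f : Fin m → ℕ) → List.sum (tabulate f) ≡ ∑[ i < m ] f i
  sum-tabulate {zero}  f = refl
  sum-tabulate {suc m} f = cong (f zero +_) (sum-tabulate (f ∘ suc))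

count-false : count {n} (λ _ → false) ≡ 0
count-false {n} = trans (count≡∑ {n} (λ _ → false)) (sum-replicate-zero n)

count-≥1 : (p : Fin n → Bool) (i : Fin n) → p i ≡ true → 1 ≤ count p
count-≥1 p i pᵢ = begin
  1                           ≡⟨ cong indicator (sym pᵢ) ⟩
  indicator (p i)             ≤⟨ term≤∑ (indicator ∘ p) i ⟩
  ∑[ j < _ ] indicator (p j)  ≡⟨ count≡∑ p ⟨
  count p                     ∎
  where open ≤-Reasoning

count-split : (p q : Fin n → Bool) → (∀ i → q i ≡ true → p i ≡ true) →
              count p ≡ count (λ i → p i ∧ not (q i)) + count q
count-split {n} p q q⊆p = begin
  count p                                           ≡⟨ count≡∑ p ⟩
  ∑[ i < n ] indicator (p i)                        ≡⟨ sum-cong-≗ split ⟩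
  ∑[ i < n ] (indicator (p∖q i) + indicator (q i))  ≡⟨ ∑-distrib-+ (indicator ∘ p∖q) (indicator ∘ q) ⟩
  ∑[ i < n ] indicator (p∖q i) + ∑[ i < n ] indicator (q i)
                                                    ≡⟨ cong₂ _+_ (count≡∑ p∖q) (count≡∑ q) ⟨
  count p∖q + count q                               ∎
  where
  open ≡-Reasoning
  p∖q : Fin n → Bool
  p∖q i = p i ∧ not (q i)
  split : ∀ i → indicator (p i) ≡ indicator (p∖q i) + indicator (q i)
  split i with q i in qᵢ
  ... | true  rewrite q⊆p i qᵢ = refl
  ... | false rewrite Bool.∧-identityʳ (p i) = sym (+-identityʳ _)

⊆ₑ-trans : {F G H : EdgeSet n} → F ⊆ₑ G → G ⊆ₑ H → F ⊆ₑ H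
⊆ₑ-trans F⊆G G⊆H u v = G⊆H u v ∘ F⊆G u v

∖ₑ-⊆ : (F M : EdgeSet n) → (F ∖ₑ M) ⊆ₑ F
∖ₑ-⊆ F M u v = Bool.∧-conicalˡ (F u v) _

deg-∖ₑ-split : {F M : EdgeSet n} → M ⊆ₑ F → ∀ u → deg F (inj₁ u) ≡ deg (F ∖ₑ M) (inj₁ u) + deg M (inj₁ u)
deg-∖ₑ-split {F = F} {M} M⊆F u = count-split (F u) (M u) (M⊆F u)

∑-deg⁺≡∑-deg⁻ : (F : EdgeSet n) → ∑[ u < n ] deg F (inj₁ u) ≡ ∑[ v < n ] deg F (inj₂ v)
∑-deg⁺≡∑-deg⁻ {n} F = begin
  ∑[ u < n ] deg F (inj₁ u)                    ≡⟨ sum-cong-≗ (λ u → count≡∑ (F u)) ⟩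
  ∑[ u < n ] ∑[ v < n ] indicator (F u v)      ≡⟨ ∑-comm (λ u v → indicator (F u v)) ⟩
  ∑[ v < n ] ∑[ u < n ] indicator (F u v)      ≡⟨ sum-cong-≗ (λ v → count≡∑ (λ u → F u v)) ⟨
  ∑[ v < n ] deg F (inj₂ v)                    ∎
  where open ≡-Reasoning

deg≡1-by-double-counting : (F : EdgeSet n) → (∀ u → deg F (inj₁ u) ≤ 1) → (∀ v → 1 ≤ deg F (inj₂ v)) →
                           ∀ x → deg F x ≡ 1
deg≡1-by-double-counting {n} F deg⁺≤1 1≤deg⁻ (inj₁ u) = ∑-mono-≤-rigid deg⁺≤1 (begin
  ∑[ v < n ] 1                ≤⟨ ∑-mono-≤ 1≤deg⁻ ⟩
  ∑[ v < n ] deg F (inj₂ v)   ≡⟨ ∑-deg⁺≡∑-deg⁻ F ⟨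
  ∑[ u < n ] deg F (inj₁ u)   ∎) u
  where open ≤-Reasoning
deg≡1-by-double-counting {n} F deg⁺≤1 1≤deg⁻ (inj₂ v) = sym (∑-mono-≤-rigid 1≤deg⁻ (begin
  ∑[ v < n ] deg F (inj₂ v)   ≡⟨ ∑-deg⁺≡∑-deg⁻ F ⟨
  ∑[ u < n ] deg F (inj₁ u)   ≤⟨ ∑-mono-≤ deg⁺≤1 ⟩
  ∑[ u < n ] 1                ∎) v)
  where open ≤-Reasoning

outdeg-orient⁺ : (F F′ : EdgeSet n) (u : Fin n) → outdeg (orient F F′) (inj₁ u) ≡ deg F (inj₁ u)
outdeg-orient⁺ {n} F F′ u = cong (_+ deg F (inj₁ u)) (count-false {n})

outdeg-orient⁻ : (F F′ : EdgeSet n) (v : Fin n) → outdeg (orient F F′) (inj₂ v) ≡ deg F′ (inj₂ v)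
outdeg-orient⁻ {n} F F′ v = trans (cong (deg F′ (inj₂ v) +_) (count-false {n})) (+-identityʳ _)

deg≡1+outdeg : {F M : EdgeSet n} → M ⊆ₑ F → ∀ u → deg M (inj₁ u) ≡ 1 →
               deg F (inj₁ u) ≡ suc (outdeg (orient (F ∖ₑ M) M) (inj₁ u))
deg≡1+outdeg {F = F} {M} M⊆F u deg-M≡1 = begin
  deg F (inj₁ u)                           ≡⟨ deg-∖ₑ-split M⊆F u ⟩
  deg (F ∖ₑ M) (inj₁ u) + deg M (inj₁ u)   ≡⟨ cong₂ _+_ (outdeg-orient⁺ (F ∖ₑ M) M u) (sym deg-M≡1) ⟨
  outdeg (orient (F ∖ₑ M) M) (inj₁ u) + 1  ≡⟨ +-comm _ 1 ⟩
  suc (outdeg (orient (F ∖ₑ M) M) (inj₁ u)) ∎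
  where open ≡-Reasoning

orient-mono : {F F′ M : EdgeSet n} → F ⊆ₑ F′ → ∀ x y → orient F M x y ≡ true → orient F′ M x y ≡ true
orient-mono F⊆F′ (inj₁ u) (inj₂ v) = F⊆F′ u v
orient-mono F⊆F′ (inj₂ v) (inj₁ u) = λ arc → arc

UAdj⇒Underlying-orient : (F M : EdgeSet n) → ∀ x y → UAdj F x y → Underlying (orient (F ∖ₑ M) M) x y
UAdj⇒Underlying-orient F M (inj₁ u) (inj₂ v) Fuv with M u v
... | true  = inj₂ refl
... | false rewrite Fuv = inj₁ refl
UAdj⇒Underlying-orient F M (inj₂ v) (inj₁ u) Fuv with M u v
... | true  = inj₁ refl
... | false rewrite Fuv = inj₂ refl

Reach-map : {A : Set} {R S : A → A → Set} → (∀ {x y} → R x y → S x y) → ∀ {x y} → Reach R x y → Reach S x y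
Reach-map R⇒S here           = here
Reach-map R⇒S (there xRy y⇝z) = there (R⇒S xRy) (Reach-map R⇒S y⇝z)

Least : (ℕ → Set) → Set
Least P = ∃ λ m → P m × (∀ {j} → P j → m ≤ j)

module _ {P : ℕ → Set} (P? : Decidable P) where

  least-or-none-below : ∀ m → Least P ⊎ (∀ {j} → j < m → ¬ P j)
  least-or-none-below zero = inj₂ λ ()
  least-or-none-below (suc m) with least-or-none-below m | P? m
  ... | inj₁ least | _      = inj₁ least
  ... | inj₂ none  | yes Pm = inj₁ (m , Pm , λ Pj → ≮⇒≥ λ j<m → none j<m Pj)
  ... | inj₂ none  | no ¬Pm = inj₂ λ j<1+m → [ none , (λ { refl → ¬Pm }) ]′ (m<1+n⇒m<n∨m≡n j<1+m)

  least-witness : ∀ {k} → P k → Least P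
  least-witness {k} Pk with least-or-none-below (suc k)
  ... | inj₁ least = least
  ... | inj₂ none  = ⊥-elim (none ≤-refl Pk)

any?ⱽ : {P : Vtx n → Set} → Decidable P → Dec (∃ P)
any?ⱽ P? = map′ [ (λ (u , p) → inj₁ u , p) , (λ (v , p) → inj₂ v , p) ]′
                (λ { (inj₁ u , p) → inj₁ (u , p) ; (inj₂ v , p) → inj₂ (v , p) })
                (any? (P? ∘ inj₁) ⊎-dec any? (P? ∘ inj₂))

UAdj? : (F : EdgeSet n) → ∀ x y → Dec (UAdj F x y)
UAdj? F (inj₁ u) (inj₂ v) = F u v Bool.≟ true
UAdj? F (inj₂ v) (inj₁ u) = F u v Bool.≟ true
UAdj? F (inj₁ _) (inj₁ _) = no λ ()
UAdj? F (inj₂ _) (inj₂ _) = no λ ()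

module Distance (F : EdgeSet n) (x₀ : Vtx n) (reachable : ∀ x → Reach (UAdj F) x₀ x) where

  Walk : ℕ → Vtx n → Set
  Walk zero    x = x ≡ x₀
  Walk (suc k) x = ∃ λ y → Walk k y × UAdj F y x

  walk? : ∀ k → Decidable (Walk k)
  walk? zero    x = ≡-dec _≟_ _≟_ x x₀
  walk? (suc k) x = any?ⱽ (λ y → walk? k y ×-dec UAdj? F y x)

  walk-extend : ∀ {k y x} → Walk k y → Reach (UAdj F) y x → ∃ λ l → Walk l x
  walk-extend w here          = _ , w
  walk-extend w (there y~z z⇝x) = walk-extend (_ , w , y~z) z⇝x

  shortest : ∀ x → Least (λ k → Walk k x)
  shortest x = least-witness (λ k → walk? k x) (proj₂ (walk-extend refl (reachable x)))

  dist : Vtx n → ℕ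
  dist x = proj₁ (shortest x)

  parent : ∀ x → x ≢ x₀ → ∃ λ y → UAdj F y x × dist y < dist x
  parent x x≢x₀ with shortest x
  ... | zero  , x≡x₀ , _         = ⊥-elim (x≢x₀ x≡x₀)
  ... | suc k , (y , wy , y~x) , _ = y , y~x , s≤s (proj₂ (proj₂ (shortest y)) wy)

ArborescentMatching : (E T : EdgeSet n) → Set
ArborescentMatching {n} E T = Σ (EdgeSet n) λ M → (M ⊆ₑ T) × IsPerfectMatching E M ×
  Σ (Fin n) λ r → IsSpanningInArborescence (auxDigraph E M) (orient (T ∖ₑ M) M) (inj₁ r)

DegreeCondition : EdgeSet n → Set
DegreeCondition {n} T = Σ (Fin n) λ r → (deg T (inj₁ r) ≡ 1) × (∀ u → u ≢ r → deg T (inj₁ u) ≡ 2)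

arborescentMatching⇒degreeCondition : {E T : EdgeSet n} → ArborescentMatching E T → DegreeCondition T
arborescentMatching⇒degreeCondition {T = T} (M , M⊆T , (_ , deg-M≡1) , r , (_ , _ , outdeg-r≡0 , outdeg≡1)) =
  r , deg-T r outdeg-r≡0 , λ u u≢r → deg-T u (outdeg≡1 (inj₁ u) (u≢r ∘ inj₁-injective))
  where
  deg-T : ∀ u {k} → outdeg (orient (T ∖ₑ M) M) (inj₁ u) ≡ k → deg T (inj₁ u) ≡ suc k
  deg-T u refl = deg≡1+outdeg M⊆T u (deg-M≡1 (inj₁ u))

module _ {E T : EdgeSet n} (T⊆E : T ⊆ₑ E) (connected : Connected (UAdj T))
         (r : Fin n) (deg-r≡1 : deg T (inj₁ r) ≡ 1) (deg-u≡2 : ∀ u → u ≢ r → deg T (inj₁ u) ≡ 2) where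

  open Distance T (inj₁ r) (connected (inj₁ r))

  M : EdgeSet n
  M u v = T u v ∧ does (dist (inj₁ u) <? dist (inj₂ v))

  M⊆T : M ⊆ₑ T
  M⊆T u v = Bool.∧-conicalˡ (T u v) _

  D : Digraph n
  D = orient (T ∖ₑ M) M

  edge-∈M : ∀ {u v} → T u v ≡ true → dist (inj₁ u) < dist (inj₂ v) → M u v ≡ true
  edge-∈M {u} {v} Tuv du<dv rewrite Tuv | dec-true (dist (inj₁ u) <? dist (inj₂ v)) du<dv = refl

  edge-∉M : ∀ {u v} → T u v ≡ true → dist (inj₂ v) < dist (inj₁ u) → (T ∖ₑ M) u v ≡ true
  edge-∉M {u} {v} Tuv dv<du rewrite Tuv | dec-false (dist (inj₁ u) <? dist (inj₂ v)) (<-asym dv<du) = refl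

  1≤deg-M⁻ : ∀ v → 1 ≤ deg M (inj₂ v)
  1≤deg-M⁻ v with parent (inj₂ v) (λ ())
  ... | inj₁ u , Tuv , du<dv = count-≥1 (λ u → M u v) u (edge-∈M Tuv du<dv)

  1≤deg-T∖M⁺ : ∀ u → u ≢ r → 1 ≤ deg (T ∖ₑ M) (inj₁ u)
  1≤deg-T∖M⁺ u u≢r with parent (inj₁ u) (u≢r ∘ inj₁-injective)
  ... | inj₂ v , Tuv , dv<du = count-≥1 ((T ∖ₑ M) u) v (edge-∉M Tuv dv<du)

  deg-T≤deg-T∖M+1 : ∀ u → deg T (inj₁ u) ≤ deg (T ∖ₑ M) (inj₁ u) + 1
  deg-T≤deg-T∖M+1 u with u ≟ r
  ... | yes refl = ≤-trans (≤-reflexive deg-r≡1) (m≤n+m 1 _)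
  ... | no  u≢r  = ≤-trans (≤-reflexive (deg-u≡2 u u≢r)) (+-monoˡ-≤ 1 (1≤deg-T∖M⁺ u u≢r))

  deg-M⁺≤1 : ∀ u → deg M (inj₁ u) ≤ 1
  deg-M⁺≤1 u = +-cancelˡ-≤ (deg (T ∖ₑ M) (inj₁ u)) _ _
    (≤-trans (≤-reflexive (sym (deg-∖ₑ-split M⊆T u))) (deg-T≤deg-T∖M+1 u))

  deg-M≡1 : ∀ x → deg M x ≡ 1
  deg-M≡1 = deg≡1-by-double-counting M deg-M⁺≤1 1≤deg-M⁻

  outdeg-D≡1 : ∀ x → x ≢ inj₁ r → outdeg D x ≡ 1
  outdeg-D≡1 (inj₁ u) u≢r = suc-injective (trans (sym (deg≡1+outdeg M⊆T u (deg-M≡1 (inj₁ u))))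
                                                 (deg-u≡2 u (u≢r ∘ cong inj₁)))
  outdeg-D≡1 (inj₂ v) _   = trans (outdeg-orient⁻ (T ∖ₑ M) M v) (deg-M≡1 (inj₂ v))

  outdeg-D-root≡0 : outdeg D (inj₁ r) ≡ 0
  outdeg-D-root≡0 = suc-injective (trans (sym (deg≡1+outdeg M⊆T r (deg-M≡1 (inj₁ r)))) deg-r≡1)

  degreeCondition⇒arborescentMatching : ArborescentMatching E T
  degreeCondition⇒arborescentMatching =
    M , M⊆T , (⊆ₑ-trans M⊆T T⊆E , deg-M≡1) , r ,
    ( orient-mono (⊆ₑ-trans (∖ₑ-⊆ T M) T⊆E)
    , (λ x y → Reach-map (UAdj⇒Underlying-orient T M _ _) (connected x y))
    , outdeg-D-root≡0
    , outdeg-D≡1 )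

lemma6 : (n : ℕ) (E T : EdgeSet n) → IsSpanningTree E T →
    (Σ (EdgeSet n) (λ M → (M ⊆ₑ T) × IsPerfectMatching E M ×
        Σ (Fin n) (λ r → IsSpanningInArborescence (auxDigraph E M) (orient (T ∖ₑ M) M) (inj₁ r))))
    ⇔
    (Σ (Fin n) (λ r → (deg T (inj₁ r) ≡ 1) × (∀ u → u ≢ r → deg T (inj₁ u) ≡ 2)))
lemma6 n E T (T⊆E , connected , _) =
  mk⇔ arborescentMatching⇒degreeCondition
      (λ (r , deg-r≡1 , deg-u≡2) → degreeCondition⇒arborescentMatching T⊆E connected r deg-r≡1 deg-u≡2)
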